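{- Let $\boldsymbol u$ be a faux-bonacci $\omega$-word. Then there exist an $\omega$-word $\boldsymbol f=f_2f_3f_4\cdots$ with each $f_n\in\mathcal O=\{\alpha,\beta\}$ and a seed word $w_2\in\{010,0010,1010,10010\}$ such that $\boldsymbol u=\lim_{n\to\infty}w_2\bullet(f_2f_3\cdots f_n)$.
   Context: The finite Fibonacci words are $F_0=0$, $F_1=01$, $F_{n+2}=F_{n+1}F_n$. $\pi(w)=[|w|_0,|w|_1]$, compared componentwise. For $n\ge1$ and $w=yF_n$ with $\pi(y)\le\pi(F_n)-\pi(0)$, $\alpha(w)=yF_{n+1}$, $\beta(w)=yF_{n-1}F_{n+1}$ (the result again satisfies the condition with $n+1$). For a word $w=yF_2$ with $\pi(y)\le\pi(F_2)-\pi(0)$ (e.g. the four seeds), $w\bullet\epsilon=w$ and $w\bullet(g\gamma)=(w\bullet g)\bullet\gamma$ for $g\in\mathcal O^*$ of length $k$ and $\gamma\in\mathcal O$, where $\gamma$ is applied with index $n=k+2$ to $w\bullet g=y'F_{k+2}$. For non-empty $X$, $X^-$ is $X$ with its last letter erased; a $4^-$-power is $XXXX^-$ with $X$ non-empty; a binary word is faux-bonacci if it has no factor $11$ and no factor that is a $4^-$-power. -}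

module Defs where

open import Data.Nat using (ℕ; zero; suc; _+_; _*_; _∸_; _≤_; pred)
open import Data.List using (List; []; _∷_; _++_; length; take; applyUpTo)
open import Data.Maybe using (Maybe; just; nothing)
open import Data.Product using (Σ; _×_; ∃)
open import Relation.Binary.PropositionalEquality using (_≡_; _≢_)
open import Relation.Nullary using (¬_)

data Bit : Set where
  𝟎 𝟏 : Bit

Word : Set
Word = List Bit

ωWord : Set
ωWord = ℕ → Bit

F : ℕ → Word
F zero = 𝟎 ∷ []
F (suc zero) = 𝟎 ∷ 𝟏 ∷ []
F (suc (suc n)) = F (suc n) ++ F n

_⁻ : Word → Word
[] ⁻ = []
(x ∷ []) ⁻ = []
(x ∷ y ∷ r) ⁻ = x ∷ ((y ∷ r) ⁻)

Is4⁻Power : Word → Set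
Is4⁻Power w = Σ Word (λ X → (X ≢ []) × (w ≡ X ++ X ++ X ++ (X ⁻)))

factor : ωWord → ℕ → ℕ → Word
factor u i L = applyUpTo (λ j → u (i + j)) L

FauxBonacci : ωWord → Set
FauxBonacci u =
  (∀ i → factor u i 2 ≢ 𝟏 ∷ 𝟏 ∷ [])
  × (∀ i L → ¬ Is4⁻Power (factor u i L))

data Op : Set where
  α β : Op

-- γ applied with index n to w = y F_n  (y = w with the suffix of length |F_n| removed)
--   α(y F_n) = y F_{n+1},   β(y F_n) = y F_{n-1} F_{n+1}
step : Op → ℕ → Word → Word
step α n w = take (length w ∸ length (F n)) w ++ F (suc n)
step β n w = take (length w ∸ length (F n)) w ++ F (pred n) ++ F (suc n)

applyOps : ℕ → List Op → Word → Word
applyOps n [] w = w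
applyOps n (γ ∷ gs) w = applyOps (suc n) gs (step γ n w)

-- w • g  (for w = y F₂): the k-th letter of g (0-based) is applied with index k+2
_•_ : Word → List Op → Word
w • g = applyOps 2 g w

data Seed : Word → Set where
  s010   : Seed (𝟎 ∷ 𝟏 ∷ 𝟎 ∷ [])
  s0010  : Seed (𝟎 ∷ 𝟎 ∷ 𝟏 ∷ 𝟎 ∷ [])
  s1010  : Seed (𝟏 ∷ 𝟎 ∷ 𝟏 ∷ 𝟎 ∷ [])
  s10010 : Seed (𝟏 ∷ 𝟎 ∷ 𝟎 ∷ 𝟏 ∷ 𝟎 ∷ [])

_!_ : Word → ℕ → Maybe Bit
[] ! i = nothing
(x ∷ w) ! zero = just x
(x ∷ w) ! suc i = w ! i

-- u = lim_{m→∞} W m  (convergence in the prefix/product topology: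
-- every letter of u is eventually present, at the same position, in all W m)
LimitOf : (ℕ → Word) → ωWord → Set
LimitOf W u = ∀ i → ∃ λ N → ∀ m → N ≤ m → W m ! i ≡ just (u i)

{-# OPTIONS --safe #-}
module Submission where

open import Defs
open import Data.Nat using (ℕ; _+_)
open import Data.List using (applyUpTo)
open import Data.Product using (Σ; _×_)

open import Data.Nat using (zero; suc; _≤_; _<_; _∸_; s≤s; z≤n)
open import Data.Nat.Properties
  using (+-identityʳ; +-suc; m+n∸n≡m; ≤-trans; m≤n+m; m≤m+n; +-mono-≤; ≤-<-trans)
open import Data.List using (List; []; _∷_; _++_; length; take)
open import Data.List.Properties using (++-assoc; ++-identityʳ; length-++; length-applyUpTo)
open import Data.Product using (_,_; proj₁; proj₂; ∃; map₂)
open import Data.Unit using (⊤; tt)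
open import Data.Empty using (⊥-elim)
open import Data.Maybe using (just)
open import Function using (_∘_)
open import Relation.Nullary using (¬_)
open import Relation.Binary.PropositionalEquality
  using (_≡_; _≢_; refl; sym; trans; cong; cong₂; subst; module ≡-Reasoning)

-- A faux-bonacci word has no factor 11 and no factor 000 (the 4⁻-power of 0), so after a
-- possible leading 1 it splits into blocks 01 and 0.  Reading these blocks as 0 and 1
-- desubstitutes u along the Fibonacci morphism φ : 0 ↦ 01, 1 ↦ 0, and since φ (X X X X⁻) 0
-- begins with the 4⁻-power of φ X, the desubstituted word is again faux-bonacci.  The k-th
-- operation is α or β as the k-th desubstitution of u starts with 0 or 1, and the seed is
-- fixed by the first letters of u and of its desubstitution.  As φ (y F_n) = φ(y) F_{n+1},
-- φ commutes with α and β up to a shift of the index, so the (m+1)-st approximation of u is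
-- the φ-image of the m-th approximation of the desubstitution.  By induction on m every
-- approximation is a prefix of u, and the m-th one ends in F_{m+2}, so it is longer than m.

OccursAt : Word → ωWord → ℕ → Set
OccursAt []      u p = ⊤
OccursAt (a ∷ x) u p = u p ≡ a × OccursAt x u (suc p)

applyUpTo-cong : ∀ {f g : ℕ → Bit} → (∀ j → f j ≡ g j) → ∀ L → applyUpTo f L ≡ applyUpTo g L
applyUpTo-cong f≗g zero    = refl
applyUpTo-cong f≗g (suc L) = cong₂ _∷_ (f≗g 0) (applyUpTo-cong (f≗g ∘ suc) L)

factor-suc : ∀ u p L → factor u p (suc L) ≡ u p ∷ factor u (suc p) L
factor-suc u p L = cong₂ _∷_ (cong u (+-identityʳ p)) (applyUpTo-cong (cong u ∘ +-suc p) L)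

occursAt⇒factor : ∀ u x p → OccursAt x u p → factor u p (length x) ≡ x
occursAt⇒factor u []      p _       = refl
occursAt⇒factor u (a ∷ x) p (e , o) =
  trans (factor-suc u p (length x)) (cong₂ _∷_ e (occursAt⇒factor u x (suc p) o))

factor-occursAt : ∀ u p L → OccursAt (factor u p L) u p
factor-occursAt u p zero    = tt
factor-occursAt u p (suc L) =
  subst (λ x → OccursAt x u p) (sym (factor-suc u p L)) (refl , factor-occursAt u (suc p) L)

factor≡⇒occursAt : ∀ u p L x → factor u p L ≡ x → OccursAt x u p
factor≡⇒occursAt u p L x refl = factor-occursAt u p L

occursAt-++ˡ : ∀ u x y p → OccursAt (x ++ y) u p → OccursAt x u p
occursAt-++ˡ u []      y p _       = tt
occursAt-++ˡ u (a ∷ x) y p (e , o) = e , occursAt-++ˡ u x y (suc p) o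

occursAt-! : ∀ u x p i → OccursAt x u p → i < length x → x ! i ≡ just (u (p + i))
occursAt-! u (a ∷ x) p zero    (e , _) _         = cong just (sym (trans (cong u (+-identityʳ p)) e))
occursAt-! u (a ∷ x) p (suc i) (_ , o) (s≤s i<n) =
  trans (occursAt-! u x (suc p) i o i<n) (cong (just ∘ u) (sym (+-suc p i)))

fauxBonacci-no-11 : ∀ u → FauxBonacci u → ∀ p → ¬ OccursAt (𝟏 ∷ 𝟏 ∷ []) u p
fauxBonacci-no-11 u (no-11 , _) p o = no-11 p (occursAt⇒factor u _ p o)

fauxBonacci-no-4⁻ : ∀ u → FauxBonacci u → ∀ X → X ≢ [] → ∀ p →
                    ¬ OccursAt (X ++ X ++ X ++ X ⁻) u p
fauxBonacci-no-4⁻ u (_ , no-4⁻) X X≢[] p o =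
  no-4⁻ p (length (X ++ X ++ X ++ X ⁻)) (X , X≢[] , occursAt⇒factor u _ p o)

fauxBonacci-10 : ∀ u → FauxBonacci u → ∀ p → u p ≡ 𝟏 → u (suc p) ≡ 𝟎
fauxBonacci-10 u faux p up≡𝟏 with u (suc p) in eq
... | 𝟎 = refl
... | 𝟏 = ⊥-elim (fauxBonacci-no-11 u faux p (up≡𝟏 , eq , tt))

φ : Word → Word
φ []      = []
φ (𝟎 ∷ x) = 𝟎 ∷ 𝟏 ∷ φ x
φ (𝟏 ∷ x) = 𝟎 ∷ φ x

φ-nonempty : ∀ X → X ≢ [] → φ X ≢ []
φ-nonempty []      X≢[] _ = X≢[] refl
φ-nonempty (𝟎 ∷ X) _    ()
φ-nonempty (𝟏 ∷ X) _    ()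

-- A faux-bonacci word u equals φ⁺ (u 0) (desub u): a leading 1 is kept in front of the φ-image.
φ⁺ : Bit → Word → Word
φ⁺ 𝟎 x = φ x
φ⁺ 𝟏 x = 𝟏 ∷ φ x

φ-++ : ∀ x y → φ (x ++ y) ≡ φ x ++ φ y
φ-++ []      y = refl
φ-++ (𝟎 ∷ x) y = cong (λ z → 𝟎 ∷ 𝟏 ∷ z) (φ-++ x y)
φ-++ (𝟏 ∷ x) y = cong (𝟎 ∷_) (φ-++ x y)

φ⁺-++ : ∀ a x y → φ⁺ a (x ++ y) ≡ φ⁺ a x ++ φ y
φ⁺-++ 𝟎 x y = φ-++ x y
φ⁺-++ 𝟏 x y = cong (𝟏 ∷_) (φ-++ x y)

φ-F : ∀ n → φ (F n) ≡ F (suc n)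
φ-F zero          = refl
φ-F (suc zero)    = refl
φ-F (suc (suc n)) = trans (φ-++ (F (suc n)) (F n)) (cong₂ _++_ (φ-F (suc n)) (φ-F n))

φ⁺-F : ∀ a x n → φ⁺ a (x ++ F n) ≡ φ⁺ a x ++ F (suc n)
φ⁺-F a x n = trans (φ⁺-++ a x (F n)) (cong (φ⁺ a x ++_) (φ-F n))

complement : Bit → Bit
complement 𝟎 = 𝟏
complement 𝟏 = 𝟎

firstBlock : Bit → ℕ
firstBlock 𝟎 = 0
firstBlock 𝟏 = 1

nextBlock : ℕ → Bit → ℕ
nextBlock p 𝟎 = suc p
nextBlock p 𝟏 = suc (suc p)

-- pos u i is where the i-th block (01 or 0, told apart by the letter after its 0) of u
-- starts, after a possible leading 1.
pos : ωWord → ℕ → ℕ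
pos u zero    = firstBlock (u 0)
pos u (suc i) = nextBlock (pos u i) (u (suc (pos u i)))

desub : ωWord → ωWord
desub u i = complement (u (suc (pos u i)))

pos-𝟎 : ∀ u → FauxBonacci u → ∀ i → u (pos u i) ≡ 𝟎
pos-𝟎 u faux zero with u 0 in eq
... | 𝟎 = eq
... | 𝟏 = fauxBonacci-10 u faux 0 eq
pos-𝟎 u faux (suc i) with u (suc (pos u i)) in eq
... | 𝟎 = eq
... | 𝟏 = fauxBonacci-10 u faux (suc (pos u i)) eq

block-occurs : ∀ u x p → u p ≡ 𝟎 →
               OccursAt (φ x ++ 𝟎 ∷ []) u (nextBlock p (u (suc p))) →
               OccursAt (φ (complement (u (suc p)) ∷ x) ++ 𝟎 ∷ []) u p
block-occurs u x p up≡𝟎 occ with u (suc p) in eq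
... | 𝟎 = up≡𝟎 , occ
... | 𝟏 = up≡𝟎 , eq , occ

-- The trailing 0 is the first letter of the block following the image.
desub-occurs : ∀ u → FauxBonacci u → ∀ x i →
               OccursAt x (desub u) i → OccursAt (φ x ++ 𝟎 ∷ []) u (pos u i)
desub-occurs u faux []      i _          = pos-𝟎 u faux i , tt
desub-occurs u faux (_ ∷ x) i (refl , o) =
  block-occurs u x (pos u i) (pos-𝟎 u faux i) (desub-occurs u faux x (suc i) o)

desub-occurs-0 : ∀ u → FauxBonacci u → ∀ x →
                 OccursAt x (desub u) 0 → OccursAt (φ⁺ (u 0) x ++ 𝟎 ∷ []) u 0
desub-occurs-0 u faux x o = leading (desub-occurs u faux x 0 o)
  where
  leading : OccursAt (φ x ++ 𝟎 ∷ []) u (firstBlock (u 0)) → OccursAt (φ⁺ (u 0) x ++ 𝟎 ∷ []) u 0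
  leading occ with u 0 in eq
  ... | 𝟎 = occ
  ... | 𝟏 = eq , occ

φ-⁻ : ∀ X → ∃ λ c → φ (X ⁻) ++ 𝟎 ∷ [] ≡ (φ X) ⁻ ++ c
φ-⁻ []               = 𝟎 ∷ [] , refl
φ-⁻ (𝟎 ∷ [])         = [] , refl
φ-⁻ (𝟏 ∷ [])         = 𝟎 ∷ [] , refl
φ-⁻ (𝟎 ∷ X@(𝟎 ∷ _)) = map₂ (cong (λ z → 𝟎 ∷ 𝟏 ∷ z)) (φ-⁻ X)
φ-⁻ (𝟎 ∷ X@(𝟏 ∷ _)) = map₂ (cong (λ z → 𝟎 ∷ 𝟏 ∷ z)) (φ-⁻ X)
φ-⁻ (𝟏 ∷ X@(𝟎 ∷ _)) = map₂ (cong (𝟎 ∷_)) (φ-⁻ X)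
φ-⁻ (𝟏 ∷ X@(𝟏 ∷ _)) = map₂ (cong (𝟎 ∷_)) (φ-⁻ X)

++-assoc₄ : ∀ (A B C D E : Word) → (A ++ B ++ C ++ D) ++ E ≡ A ++ B ++ C ++ D ++ E
++-assoc₄ A B C D E =
  trans (++-assoc A _ E) (cong (A ++_) (trans (++-assoc B _ E) (cong (B ++_) (++-assoc C D E))))

φ-4⁻-power : ∀ X → ∃ λ c →
  φ (X ++ X ++ X ++ X ⁻) ++ 𝟎 ∷ [] ≡ (φ X ++ φ X ++ φ X ++ (φ X) ⁻) ++ c
φ-4⁻-power X = c , (begin
    φ (X ++ X ++ X ++ X ⁻) ++ 𝟎 ∷ []
  ≡⟨ cong (_++ 𝟎 ∷ []) φ-distrib ⟩
    (Y ++ Y ++ Y ++ φ (X ⁻)) ++ 𝟎 ∷ []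
  ≡⟨ ++-assoc₄ Y Y Y (φ (X ⁻)) (𝟎 ∷ []) ⟩
    Y ++ Y ++ Y ++ φ (X ⁻) ++ 𝟎 ∷ []
  ≡⟨ cong (λ z → Y ++ Y ++ Y ++ z) eq ⟩
    Y ++ Y ++ Y ++ Y ⁻ ++ c
  ≡⟨ ++-assoc₄ Y Y Y (Y ⁻) c ⟨
    (Y ++ Y ++ Y ++ Y ⁻) ++ c ∎)
  where
  open ≡-Reasoning
  Y = φ X
  c = proj₁ (φ-⁻ X)
  eq = proj₂ (φ-⁻ X)
  φ-distrib : φ (X ++ X ++ X ++ X ⁻) ≡ Y ++ Y ++ Y ++ φ (X ⁻)
  φ-distrib = trans (φ-++ X _) (cong (Y ++_) (trans (φ-++ X _) (cong (Y ++_) (φ-++ X (X ⁻)))))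

desub-fauxBonacci : ∀ u → FauxBonacci u → FauxBonacci (desub u)
desub-fauxBonacci u faux = no-11 , no-4⁻
  where
  -- φ (11) 0 = 000 is the 4⁻-power of 0.
  no-11 : ∀ i → factor (desub u) i 2 ≢ 𝟏 ∷ 𝟏 ∷ []
  no-11 i eq = fauxBonacci-no-4⁻ u faux (𝟎 ∷ []) (λ ()) (pos u i)
    (desub-occurs u faux (𝟏 ∷ 𝟏 ∷ []) i (factor≡⇒occursAt (desub u) i 2 _ eq))
  no-4⁻ : ∀ i L → ¬ Is4⁻Power (factor (desub u) i L)
  no-4⁻ i L (X , X≢[] , eq) = fauxBonacci-no-4⁻ u faux (φ X) (φ-nonempty X X≢[]) (pos u i)
    (occursAt-++ˡ u _ c (pos u i) (subst (λ z → OccursAt z u (pos u i)) image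
      (desub-occurs u faux _ i (factor≡⇒occursAt (desub u) i L _ eq))))
    where
    c = proj₁ (φ-4⁻-power X)
    image = proj₂ (φ-4⁻-power X)

take-length-++ : ∀ (y z : Word) → take (length y) (y ++ z) ≡ y
take-length-++ []      z = refl
take-length-++ (a ∷ y) z = cong (a ∷_) (take-length-++ y z)

suffix-removed : ∀ (y z : Word) → take (length (y ++ z) ∸ length z) (y ++ z) ≡ y
suffix-removed y z =
  trans (cong (λ n → take (n ∸ length z) (y ++ z)) (length-++ y))
        (trans (cong (λ n → take n (y ++ z)) (m+n∸n≡m (length y) (length z))) (take-length-++ y z))

inserted : Op → ℕ → Word
inserted α n = []
inserted β n = F n

step-F : ∀ γ n y → step γ (suc n) (y ++ F (suc n)) ≡ (y ++ inserted γ n) ++ F (suc (suc n))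
step-F α n y = cong (_++ F (suc (suc n))) (trans (suffix-removed y (F (suc n))) (sym (++-identityʳ y)))
step-F β n y = trans (cong (_++ F n ++ F (suc (suc n))) (suffix-removed y (F (suc n))))
                     (sym (++-assoc y (F n) _))

φ-inserted : ∀ γ n → φ (inserted γ n) ≡ inserted γ (suc n)
φ-inserted α n = refl
φ-inserted β n = φ-F n

applyOps-F : ∀ n gs y → ∃ λ y′ → applyOps (suc n) gs (y ++ F (suc n)) ≡ y′ ++ F (length gs + suc n)
applyOps-F n []       y = y , refl
applyOps-F n (γ ∷ gs) y rewrite step-F γ n y | sym (+-suc (length gs) (suc n)) =
  applyOps-F (suc n) gs (y ++ inserted γ n)

φ⁺-applyOps : ∀ a n gs y → φ⁺ a (applyOps (suc n) gs (y ++ F (suc n))) ≡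
              applyOps (suc (suc n)) gs (φ⁺ a y ++ F (suc (suc n)))
φ⁺-applyOps a n []       y = φ⁺-F a y (suc n)
φ⁺-applyOps a n (γ ∷ gs) y rewrite step-F γ n y | step-F γ (suc n) (φ⁺ a y) =
  trans (φ⁺-applyOps a (suc n) gs (y ++ inserted γ n))
        (cong (λ z → applyOps (suc (suc (suc n))) gs (z ++ F (suc (suc (suc n)))))
              (trans (φ⁺-++ a y (inserted γ n)) (cong (φ⁺ a y ++_) (φ-inserted γ n))))

n<length-F : ∀ n → n < length (F n)
n<length-F zero          = s≤s z≤n
n<length-F (suc zero)    = s≤s (s≤s z≤n)
n<length-F (suc (suc n)) = subst (suc (suc (suc n)) ≤_) (sym (length-++ (F (suc n))))
  (≤-trans (s≤s (s≤s (m≤n+m (suc n) n))) (+-mono-≤ (n<length-F (suc n)) (n<length-F n)))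

length-applyOps : ∀ n gs y → length gs + suc n < length (applyOps (suc n) gs (y ++ F (suc n)))
length-applyOps n gs y with applyOps-F n gs y
... | y′ , eq rewrite eq | length-++ y′ {F (length gs + suc n)} =
  ≤-trans (n<length-F (length gs + suc n)) (m≤n+m _ (length y′))

desubⁿ : ℕ → ωWord → ωWord
desubⁿ zero    u = u
desubⁿ (suc k) u = desubⁿ k (desub u)

op : Bit → Op
op 𝟎 = α
op 𝟏 = β

operations : ωWord → ℕ → Op
operations u k = op (desubⁿ k u 0)

seedPrefix : Bit → Bit → Word
seedPrefix 𝟎 𝟎 = []
seedPrefix 𝟎 𝟏 = 𝟎 ∷ []
seedPrefix 𝟏 𝟎 = 𝟏 ∷ []
seedPrefix 𝟏 𝟏 = 𝟏 ∷ 𝟎 ∷ []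

seed : Bit → Bit → Word
seed a b = seedPrefix a b ++ F 2

seed-Seed : ∀ a b → Seed (seed a b)
seed-Seed 𝟎 𝟎 = s010
seed-Seed 𝟎 𝟏 = s0010
seed-Seed 𝟏 𝟎 = s1010
seed-Seed 𝟏 𝟏 = s10010

step-seed : ∀ a b c → step (op c) 2 (seed a b) ≡ φ⁺ a (seed b c)
step-seed 𝟎 𝟎 𝟎 = refl
step-seed 𝟎 𝟎 𝟏 = refl
step-seed 𝟎 𝟏 𝟎 = refl
step-seed 𝟎 𝟏 𝟏 = refl
step-seed 𝟏 𝟎 𝟎 = refl
step-seed 𝟏 𝟎 𝟏 = refl
step-seed 𝟏 𝟏 𝟎 = refl
step-seed 𝟏 𝟏 𝟏 = refl

seed-⊑-φ⁺ : ∀ a b c → ¬ (b ≡ 𝟏 × c ≡ 𝟏) → ∃ λ d → φ⁺ a (b ∷ c ∷ []) ++ 𝟎 ∷ [] ≡ seed a b ++ d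
seed-⊑-φ⁺ 𝟎 𝟎 𝟎 _  = _ , refl
seed-⊑-φ⁺ 𝟎 𝟎 𝟏 _  = _ , refl
seed-⊑-φ⁺ 𝟎 𝟏 𝟎 _  = _ , refl
seed-⊑-φ⁺ 𝟏 𝟎 𝟎 _  = _ , refl
seed-⊑-φ⁺ 𝟏 𝟎 𝟏 _  = _ , refl
seed-⊑-φ⁺ 𝟏 𝟏 𝟎 _  = _ , refl
seed-⊑-φ⁺ a 𝟏 𝟏 ¬11 = ⊥-elim (¬11 (refl , refl))

approx : ωWord → ℕ → Word
approx u m = seed (u 0) (desub u 0) • applyUpTo (λ k → operations u (k + 2)) m

approx-suc : ∀ u m → approx u (suc m) ≡ φ⁺ (u 0) (approx (desub u) m)
approx-suc u m = begin
    applyOps 3 gs (step (op v₁) 2 (seed (u 0) v₀))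
  ≡⟨ cong (applyOps 3 gs) (step-seed (u 0) v₀ v₁) ⟩
    applyOps 3 gs (φ⁺ (u 0) (seedPrefix v₀ v₁ ++ F 2))
  ≡⟨ cong (applyOps 3 gs) (φ⁺-F (u 0) (seedPrefix v₀ v₁) 2) ⟩
    applyOps 3 gs (φ⁺ (u 0) (seedPrefix v₀ v₁) ++ F 3)
  ≡⟨ φ⁺-applyOps (u 0) 1 gs (seedPrefix v₀ v₁) ⟨
    φ⁺ (u 0) (approx (desub u) m) ∎
  where
  open ≡-Reasoning
  v₀ = desub u 0
  v₁ = desub (desub u) 0
  gs = applyUpTo (λ k → operations (desub u) (k + 2)) m

approx-occurs : ∀ m u → FauxBonacci u → OccursAt (approx u m) u 0
approx-occurs zero u faux =
  occursAt-++ˡ u _ d 0 (subst (λ z → OccursAt z u 0) seed⊑ (desub-occurs-0 u faux _ (refl , refl , tt)))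
  where
  v = desub u
  no-11 : ¬ (v 0 ≡ 𝟏 × v 1 ≡ 𝟏)
  no-11 (v₀≡𝟏 , v₁≡𝟏) = fauxBonacci-no-11 v (desub-fauxBonacci u faux) 0 (v₀≡𝟏 , v₁≡𝟏 , tt)
  d = proj₁ (seed-⊑-φ⁺ (u 0) (v 0) (v 1) no-11)
  seed⊑ = proj₂ (seed-⊑-φ⁺ (u 0) (v 0) (v 1) no-11)
approx-occurs (suc m) u faux = subst (λ z → OccursAt z u 0) (sym (approx-suc u m))
  (occursAt-++ˡ u _ (𝟎 ∷ []) 0
    (desub-occurs-0 u faux _ (approx-occurs m (desub u) (desub-fauxBonacci u faux))))

m<length-approx : ∀ u m → m < length (approx u m)
m<length-approx u m = ≤-<-trans m≤|gs|+2 (length-applyOps 1 gs (seedPrefix (u 0) (desub u 0)))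
  where
  gs = applyUpTo (λ k → operations u (k + 2)) m
  m≤|gs|+2 : m ≤ length gs + 2
  m≤|gs|+2 = subst (λ n → m ≤ n + 2) (sym (length-applyUpTo _ m)) (m≤m+n m 2)

corollary2 : (u : ωWord) → FauxBonacci u →
    Σ (ℕ → Op) (λ f → Σ Word (λ w₂ →
      Seed w₂ × LimitOf (λ m → w₂ • applyUpTo (λ k → f (k + 2)) m) u))
corollary2 u faux =
  operations u , seed (u 0) (desub u 0) , seed-Seed (u 0) (desub u 0) ,
  λ i → i , λ m i≤m →
    occursAt-! u (approx u m) 0 i (approx-occurs m u faux) (≤-trans (s≤s i≤m) (m<length-approx u m))
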